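{- Let $p_0,p_1,p_2$ be positive integers with $\gcd(p_0,p_1,p_2)=1$, and put $n=p_0+p_1+p_2$. Let $E=(\mathbb{Z}/n\mathbb{Z})\times\{0,1,2\}$, and let $\sigma_0,\sigma_1$ be the permutations of $E$ defined for $m\in\mathbb{Z}/n\mathbb{Z}$ by $$\sigma_0(m,0)=(m,1),\quad \sigma_0(m,1)=(m,2),\quad \sigma_0(m,2)=(m,0),$$ $$\sigma_1(m,0)=(m-p_1,2),\quad \sigma_1(m,1)=(m-p_2,0),\quad \sigma_1(m,2)=(m-p_0,1).$$ Let $\alpha=\gcd(n,p_0p_1-p_2^2)$. Then the subgroup $\langle\sigma_0\sigma_1,\sigma_1\sigma_0\rangle$ of the symmetric group on $E$ has order $\frac{n^2}{\alpha}$.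
   Context: Composition of permutations is as functions: $(\sigma\tau)(x)=\sigma(\tau(x))$. -}

module Defs where

open import Data.Nat using (ℕ; zero; suc; _+_; _*_; _∸_; _%_; ∣_-_∣)
open import Data.Nat.DivMod using (_mod_)
open import Data.Fin using (Fin; toℕ; zero; suc)
open import Data.Product using (Σ; ∃; _×_; _,_)
open import Function using (_∘_; id)
open import Relation.Binary.PropositionalEquality using (_≡_; _≗_)

-- ℤ/nℤ is represented by Fin n; (m - p) mod n for m ∈ ℤ/nℤ and p ∈ ℕ
subMod : ∀ {n} → Fin n → ℕ → Fin n
subMod {suc k} m p = (toℕ m + (suc k ∸ (p % suc k))) mod (suc k)

E : ℕ → Set
E n = Fin n × Fin 3

σ₀ : ∀ {n} → E n → E n
σ₀ (m , zero) = (m , suc zero)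
σ₀ (m , suc zero) = (m , suc (suc zero))
σ₀ (m , suc (suc zero)) = (m , zero)

σ₁ : ∀ {n} (p₀ p₁ p₂ : ℕ) → E n → E n
σ₁ p₀ p₁ p₂ (m , zero) = (subMod m p₁ , suc (suc zero))
σ₁ p₀ p₁ p₂ (m , suc zero) = (subMod m p₂ , zero)
σ₁ p₀ p₁ p₂ (m , suc (suc zero)) = (subMod m p₀ , suc zero)

-- The subgroup of Sym(A) generated by the permutations a and b,
-- as a predicate on functions A → A (closed under extensional equality).
data Gen {A : Set} (a b : A → A) : (A → A) → Set where
  gen-a : Gen a b a
  gen-b : Gen a b b
  gen-id : Gen a b id
  gen-comp : ∀ {f g} → Gen a b f → Gen a b g → Gen a b (f ∘ g)
  gen-inv : ∀ {f g} → Gen a b f → (g ∘ f) ≗ id → (f ∘ g) ≗ id → Gen a b g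
  gen-ext : ∀ {f g} → Gen a b f → f ≗ g → Gen a b g

-- A set P of functions A → A (elements taken up to extensional equality)
-- has exactly N elements.
HasOrder : {A : Set} → ((A → A) → Set) → ℕ → Set
HasOrder {A} P N =
  Σ (Fin N → (A → A)) λ e →
    (∀ i → P (e i)) ×
    (∀ i j → e i ≗ e j → i ≡ j) ×
    (∀ f → P f → ∃ λ i → f ≗ e i)

module Submission where

-- σ₀σ₁ and σ₁σ₀ keep the layer ℓ ∈ {0,1,2} of every point of E and translate its ℤ/nℤ
-- coordinate by g_ℓ and h_ℓ respectively, where g = (−p₁, −p₂, −p₀) and h = (−p₂, −p₀, −p₁).
-- Hence the group they generate is the group of translations by the subgroup L of (ℤ/nℤ)³
-- spanned by g and h, and it remains to count L. Since gcd(p₁, p₂, n) = gcd(p₀, p₁, p₂) = 1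
-- there are X, Y with X p₁ + Y p₂ ≡ 1 (mod n); put e = X p₂ + Y p₀. Every vector of L has
-- coordinate sum 0 and second coordinate ≡ e · (first coordinate) modulo α, and conversely
-- every such vector is an explicit combination of g and h. So L consists of the n · (n/α)
-- distinct vectors (s, e s + k α, −(s + e s + k α)) with s ∈ ℤ/nℤ and k ∈ ℤ/(n/α)ℤ.

open import Data.Fin using (Fin; toℕ; fromℕ<)
open import Data.Fin.Patterns using (0F; 1F; 2F)
open import Data.Fin.Properties using (toℕ-fromℕ<; toℕ-injective; toℕ<n; *↔×)
open import Data.Integer using (ℤ)
open import Data.Nat as ℕ using (ℕ; NonZero; _<_; _∸_)
import Data.Nat.DivMod as ℕ
open import Data.Nat.Divisibility as ℕ using (∣-trans; ∣m+n∣m⇒∣n; ∣1⇒≡1)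
open import Data.Nat.GCD using (gcd; gcd[m,n]∣m; gcd[m,n]∣n; gcd-greatest; gcd-GCD; module Bézout)
import Data.Nat.Properties as ℕ
open import Data.Product using (∃; ∃₂; _×_; _,_; proj₁; proj₂; uncurry)
open import Data.Sum using (inj₁; inj₂)
open import Data.Vec.Functional using (Vector; map; zipWith; replicate)
open import Function using (_∘_; id)
open import Function.Bundles using (_↔_; Inverse)
open import Relation.Binary.Bundles using (Setoid)
import Relation.Binary.Reasoning.Setoid as SetoidReasoning
open import Relation.Binary.PropositionalEquality
open import Defs

gcd[gcd[p,q],r]≡1⇒gcd[gcd[q,r],p+q+r]≡1 : ∀ p q r → gcd (gcd p q) r ≡ 1 →
                                          gcd (gcd q r) (p ℕ.+ q ℕ.+ r) ≡ 1
gcd[gcd[p,q],r]≡1⇒gcd[gcd[q,r],p+q+r]≡1 p q r coprime =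
  ∣1⇒≡1 (subst (d ℕ.∣_) coprime (gcd-greatest (gcd-greatest d∣p d∣q) d∣r))
  where
  d = gcd (gcd q r) (p ℕ.+ q ℕ.+ r)
  d∣q = ∣-trans (gcd[m,n]∣m _ _) (gcd[m,n]∣m q r)
  d∣r = ∣-trans (gcd[m,n]∣m _ _) (gcd[m,n]∣n q r)
  d∣p+q+r = gcd[m,n]∣n (gcd q r) (p ℕ.+ q ℕ.+ r)
  d∣p+q = ∣m+n∣m⇒∣n (subst (d ℕ.∣_) (ℕ.+-comm (p ℕ.+ q) r) d∣p+q+r) d∣r
  d∣p = ∣m+n∣m⇒∣n (subst (d ℕ.∣_) (ℕ.+-comm p q) d∣p+q) d∣q

hasOrder-↔ : ∀ {A B : Set} {P : (A → A) → Set} {N} → Fin N ↔ B → (e : B → A → A) →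
             (∀ b → P (e b)) → (∀ b b′ → e b ≗ e b′ → b ≡ b′) → (∀ f → P f → ∃ λ b → f ≗ e b) →
             HasOrder P N
hasOrder-↔ {P = P} ι e e∈P e-injective e-covers = e ∘ to , e∈P ∘ to , injective , covers
  where
  open Inverse ι
  injective : ∀ i j → e (to i) ≗ e (to j) → i ≡ j
  injective i j eq = begin
    i            ≡⟨ strictlyInverseʳ i ⟨
    from (to i)  ≡⟨ cong from (e-injective (to i) (to j) eq) ⟩
    from (to j)  ≡⟨ strictlyInverseʳ j ⟩
    j            ∎
    where open ≡-Reasoning
  covers : ∀ f → P f → ∃ λ i → f ≗ e (to i)
  covers f f∈P with e-covers f f∈P
  ... | b , f≗eb = from b , λ x → trans (f≗eb x) (cong (λ b′ → e b′ x) (sym (strictlyInverseˡ b)))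

module Congruence where

  open import Data.Integer as ℤ using (+_; -[1+_]; 0ℤ; 1ℤ; _+_; _*_; -_; _-_; _%ℕ_; _/ℕ_)
  import Data.Integer.Properties as ℤ
  open import Data.Integer.Tactic.RingSolver using (solve)
  open import Data.List.Base using ([]; _∷_)
  open import Data.Integer.DivMod using (n%ℕd<d; a≡a%ℕn+[a/ℕn]*n)
  open import Data.Integer.Divisibility.Signed using (_∣_; ∣m∣n⇒∣m+n; ∣n⇒∣m*n)

  infix 4 _≡_mod_
  record _≡_mod_ (a b m : ℤ) : Set where
    constructor congruent
    field
      quotient : ℤ
      equation : a ≡ b + quotient * m

  module _ {m : ℤ} where

    ≡⇒≡-mod : ∀ {a b} → a ≡ b → a ≡ b mod m
    ≡⇒≡-mod {a} refl = congruent 0ℤ (solve (a ∷ m ∷ []))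

    ≡-mod-refl : ∀ {a} → a ≡ a mod m
    ≡-mod-refl = ≡⇒≡-mod refl

    ≡-mod-sym : ∀ {a b} → a ≡ b mod m → b ≡ a mod m
    ≡-mod-sym {b = b} (congruent q refl) = congruent (- q) (solve (b ∷ q ∷ m ∷ []))

    ≡-mod-trans : ∀ {a b c} → a ≡ b mod m → b ≡ c mod m → a ≡ c mod m
    ≡-mod-trans {c = c} (congruent q refl) (congruent r refl) =
      congruent (r + q) (solve (c ∷ r ∷ q ∷ m ∷ []))

    +-cong-mod : ∀ {a b c d} → a ≡ b mod m → c ≡ d mod m → a + c ≡ b + d mod m
    +-cong-mod {b = b} {d = d} (congruent q refl) (congruent r refl) =
      congruent (q + r) (solve (b ∷ d ∷ q ∷ r ∷ m ∷ []))

    +-congˡ-mod : ∀ c {a b} → a ≡ b mod m → c + a ≡ c + b mod m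
    +-congˡ-mod c = +-cong-mod (≡-mod-refl {c})

    +-congʳ-mod : ∀ c {a b} → a ≡ b mod m → a + c ≡ b + c mod m
    +-congʳ-mod c a≡b = +-cong-mod a≡b (≡-mod-refl {c})

    *-congˡ-mod : ∀ c {a b} → a ≡ b mod m → c * a ≡ c * b mod m
    *-congˡ-mod c {b = b} (congruent q refl) = congruent (c * q) (solve (c ∷ b ∷ q ∷ m ∷ []))

    *-congʳ-mod : ∀ c {a b} → a ≡ b mod m → a * c ≡ b * c mod m
    *-congʳ-mod c {b = b} (congruent q refl) = congruent (q * c) (solve (c ∷ b ∷ q ∷ m ∷ []))

    neg-cong-mod : ∀ {a b} → a ≡ b mod m → - a ≡ - b mod m
    neg-cong-mod {b = b} (congruent q refl) = congruent (- q) (solve (b ∷ q ∷ m ∷ []))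

    +-cancelˡ-mod : ∀ a {b c} → a + b ≡ a + c mod m → b ≡ c mod m
    +-cancelˡ-mod a {b} {c} (congruent q eq) = congruent q (begin
      b                     ≡⟨ solve (a ∷ b ∷ []) ⟩
      - a + (a + b)         ≡⟨ cong (_+_ (- a)) eq ⟩
      - a + (a + c + q * m) ≡⟨ solve (a ∷ c ∷ q ∷ m ∷ []) ⟩
      c + q * m             ∎)
      where open ≡-Reasoning

    ≡-mod-self : m ≡ 0ℤ mod m
    ≡-mod-self = congruent 1ℤ (solve (m ∷ []))

    *-multiple≡0-mod : ∀ q → q * m ≡ 0ℤ mod m
    *-multiple≡0-mod q = congruent q (solve (q ∷ m ∷ []))

    ∣-resp-≡-mod : ∀ {d a b} → d ∣ m → a ≡ b mod m → d ∣ b → d ∣ a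
    ∣-resp-≡-mod {d} d∣m (congruent q eq) d∣b =
      subst (d ∣_) (sym eq) (∣m∣n⇒∣m+n d∣b (∣n⇒∣m*n q d∣m))

    *-scale-mod : ∀ d {a b} → a ≡ b mod m → a * d ≡ b * d mod m * d
    *-scale-mod d {b = b} (congruent q refl) = congruent q (solve (b ∷ q ∷ m ∷ d ∷ []))

    *-cancelʳ-scaled-mod : ∀ d {a b} .{{_ : ℤ.NonZero d}} → a * d ≡ b * d mod m * d → a ≡ b mod m
    *-cancelʳ-scaled-mod d {a} {b} (congruent q eq) =
      congruent q (ℤ.*-cancelʳ-≡ a (b + q * m) d (trans eq (solve (b ∷ q ∷ m ∷ d ∷ []))))

  ≡-mod-setoid : ℤ → Setoid _ _
  ≡-mod-setoid m = record
    { Carrier = ℤ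
    ; _≈_ = λ a b → a ≡ b mod m
    ; isEquivalence = record { refl = ≡-mod-refl ; sym = ≡-mod-sym ; trans = ≡-mod-trans }
    }

  module ≡-mod-Reasoning (m : ℤ) = SetoidReasoning (≡-mod-setoid m)

  residue-unique : ∀ {m} .{{_ : NonZero m}} {r s} q →
                   r < m → s < m → r ≡ s ℕ.+ q ℕ.* m → r ≡ s
  residue-unique {m} {r} {s} q r<m s<m r≡s+qm = begin
    r                       ≡⟨ ℕ.m<n⇒m%n≡m r<m ⟨
    r ℕ.% m                 ≡⟨ cong (ℕ._% m) r≡s+qm ⟩
    (s ℕ.+ q ℕ.* m) ℕ.% m   ≡⟨ ℕ.[m+kn]%n≡m%n s q m ⟩
    s ℕ.% m                 ≡⟨ ℕ.m<n⇒m%n≡m s<m ⟩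
    s                       ∎
    where open ≡-Reasoning

  pos-+-* : ∀ s q m → + (s ℕ.+ q ℕ.* m) ≡ + s + + q * + m
  pos-+-* s q m = trans (ℤ.pos-+ s (q ℕ.* m)) (cong (_+_ (+ s)) (ℤ.pos-* q m))

  pos-congruence : ∀ {r} s q m → + r ≡ + s + + q * + m → r ≡ s ℕ.+ q ℕ.* m
  pos-congruence s q m eq = ℤ.+-injective (trans eq (sym (pos-+-* s q m)))

  toℕ-injective-mod : ∀ {m} .{{_ : NonZero m}} (i j : Fin m) →
                      + toℕ i ≡ + toℕ j mod + m → i ≡ j
  toℕ-injective-mod {m} i j (congruent (+ q) eq) =
    toℕ-injective (residue-unique q (toℕ<n i) (toℕ<n j) (pos-congruence (toℕ j) q m eq))
  toℕ-injective-mod {m} i j (congruent -[1+ q ] eq) =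
    sym (toℕ-injective (residue-unique (ℕ.suc q) (toℕ<n j) (toℕ<n i) j≡i+[1+q]m))
    where
    swap-sides : ∀ {a b m} q → a ≡ b + - q * m → b ≡ a + q * m
    swap-sides {b = b} {m} q refl = solve (b ∷ q ∷ m ∷ [])
    j≡i+[1+q]m : toℕ j ≡ toℕ i ℕ.+ ℕ.suc q ℕ.* m
    j≡i+[1+q]m = pos-congruence (toℕ i) (ℕ.suc q) m (swap-sides {m = + m} (+ ℕ.suc q) eq)

  module _ {m : ℕ} .{{_ : NonZero m}} where

    reduce : ℤ → Fin m
    reduce x = fromℕ< (n%ℕd<d x m)

    ≡-mod-reduce : ∀ x → x ≡ + toℕ (reduce x) mod + m
    ≡-mod-reduce x = congruent (x /ℕ m) (begin
      x                                     ≡⟨ a≡a%ℕn+[a/ℕn]*n x m ⟩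
      + (x %ℕ m) + (x /ℕ m) * + m           ≡⟨ cong (λ r → + r + (x /ℕ m) * + m) (toℕ-fromℕ< _) ⟨
      + toℕ (reduce x) + (x /ℕ m) * + m     ∎)
      where open ≡-Reasoning

    reduce-cong : ∀ {x y} → x ≡ y mod + m → reduce x ≡ reduce y
    reduce-cong {x} {y} x≡y = toℕ-injective-mod _ _ (begin
      + toℕ (reduce x)  ≈⟨ ≡-mod-reduce x ⟨
      x                 ≈⟨ x≡y ⟩
      y                 ≈⟨ ≡-mod-reduce y ⟩
      + toℕ (reduce y)  ∎)
      where open ≡-mod-Reasoning (+ m)

    reduce-injective : ∀ {x y} → reduce x ≡ reduce y → x ≡ y mod + m
    reduce-injective {x} {y} eq = begin
      x                 ≈⟨ ≡-mod-reduce x ⟩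
      + toℕ (reduce x)  ≡⟨ cong (λ i → + toℕ i) eq ⟩
      + toℕ (reduce y)  ≈⟨ ≡-mod-reduce y ⟨
      y                 ∎
      where open ≡-mod-Reasoning (+ m)

    reduce-toℕ : ∀ i → reduce (+ toℕ i) ≡ i
    reduce-toℕ i = toℕ-injective-mod _ _ (≡-mod-sym (≡-mod-reduce (+ toℕ i)))

    shift : ℤ → Fin m → Fin m
    shift c i = reduce (+ toℕ i + c)

    shift-shift : ∀ c d i → shift c (shift d i) ≡ shift (d + c) i
    shift-shift c d i = reduce-cong (begin
      + toℕ (reduce (+ toℕ i + d)) + c  ≈⟨ +-congʳ-mod c (≡-mod-reduce (+ toℕ i + d)) ⟨
      + toℕ i + d + c                   ≡⟨ ℤ.+-assoc (+ toℕ i) d c ⟩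
      + toℕ i + (d + c)                 ∎)
      where open ≡-mod-Reasoning (+ m)

    shift-cong : ∀ {c d} i → c ≡ d mod + m → shift c i ≡ shift d i
    shift-cong i c≡d = reduce-cong (+-congˡ-mod (+ toℕ i) c≡d)

    shift-zero : ∀ i → shift 0ℤ i ≡ i
    shift-zero i = trans (cong reduce (ℤ.+-identityʳ (+ toℕ i))) (reduce-toℕ i)

    shift-injective : ∀ {c d} i → shift c i ≡ shift d i → c ≡ d mod + m
    shift-injective i eq = +-cancelˡ-mod (+ toℕ i) (reduce-injective eq)

  subMod≡shift : ∀ {n} .{{_ : NonZero n}} (i : Fin n) p → subMod i p ≡ shift (- + p) i
  subMod≡shift {n@(ℕ.suc _)} i p = reduce-cong (begin
    + (toℕ i ℕ.+ (n ∸ r))   ≡⟨ ℤ.pos-+ (toℕ i) (n ∸ r) ⟩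
    + toℕ i + + (n ∸ r)     ≡⟨ cong (_+_ (+ toℕ i)) n-r ⟨
    + toℕ i + (+ n - + r)   ≈⟨ +-congˡ-mod (+ toℕ i) (+-congʳ-mod (- + r) ≡-mod-self) ⟩
    + toℕ i + (0ℤ - + r)    ≡⟨ cong (_+_ (+ toℕ i)) (ℤ.+-identityˡ (- + r)) ⟩
    + toℕ i - + r           ≈⟨ +-congˡ-mod (+ toℕ i) (neg-cong-mod r≡p) ⟩
    + toℕ i - + p           ∎)
    where
    open ≡-mod-Reasoning (+ n)
    r = p ℕ.% n
    n-r : + n - + r ≡ + (n ∸ r)
    n-r = trans (ℤ.m-n≡m⊖n n r) (ℤ.⊖-≥ (ℕ.m%n≤n p n))
    r≡p : + r ≡ + p mod + n
    r≡p = ≡-mod-sym (congruent (+ (p ℕ./ n))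
            (trans (cong +_ (ℕ.m≡m%n+[m/n]*n p n)) (pos-+-* r (p ℕ./ n) n)))

module IntegerBézout where

  open import Data.Integer as ℤ using (+_; 1ℤ; _+_; _*_; -_; _-_; _⊖_)
  import Data.Integer.Properties as ℤ
  open import Data.Integer.Tactic.RingSolver using (solve-∀)

  pos-difference : ∀ {d u v} → d ℕ.+ u ≡ v → + d ≡ + v - + u
  pos-difference {d} {u} {v} eq = begin
    + d              ≡⟨ identity (+ d) (+ u) ⟩
    + d + + u - + u  ≡⟨ cong (_- + u) (trans (sym (ℤ.pos-+ d u)) (cong +_ eq)) ⟩
    + v - + u        ∎
    where
    open ≡-Reasoning
    identity : ∀ a b → a ≡ a + b - b
    identity = solve-∀

  bézout : ∀ a b → ∃₂ λ x y → + gcd a b ≡ x * + a + y * + b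
  bézout a b with Bézout.identity (gcd-GCD a b)
  ... | Bézout.+- x y eq = + x , - + y , (begin
    + gcd a b                   ≡⟨ pos-difference eq ⟩
    + (x ℕ.* a) - + (y ℕ.* b)   ≡⟨ cong₂ _-_ (ℤ.pos-* x a) (ℤ.pos-* y b) ⟩
    + x * + a - + y * + b       ≡⟨ cong (_+_ (+ x * + a)) (ℤ.neg-distribˡ-* (+ y) (+ b)) ⟩
    + x * + a + - + y * + b     ∎)
    where open ≡-Reasoning
  ... | Bézout.-+ x y eq = - + x , + y , (begin
    + gcd a b                   ≡⟨ pos-difference eq ⟩
    + (y ℕ.* b) - + (x ℕ.* a)   ≡⟨ cong₂ _-_ (ℤ.pos-* y b) (ℤ.pos-* x a) ⟩
    + y * + b - + x * + a       ≡⟨ ℤ.+-comm (+ y * + b) _ ⟩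
    - (+ x * + a) + + y * + b   ≡⟨ cong (_+ + y * + b) (ℤ.neg-distribˡ-* (+ x) (+ a)) ⟩
    - + x * + a + + y * + b     ∎)
    where open ≡-Reasoning

  bézoutℤ : ∀ a i → ∃₂ λ x y → + gcd a ℤ.∣ i ∣ ≡ x * + a + y * i
  bézoutℤ a i with bézout a ℤ.∣ i ∣ | ℤ.+∣i∣≡i⊎+∣i∣≡-i i
  ... | x , y , eq | inj₁ ∣i∣≡i = x , y , trans eq (cong (λ j → x * + a + y * j) ∣i∣≡i)
  ... | x , y , eq | inj₂ ∣i∣≡-i = x , - y , trans eq (cong (_+_ (x * + a)) (begin
    y * + ℤ.∣ i ∣  ≡⟨ cong (y *_) ∣i∣≡-i ⟩
    y * - i        ≡⟨ ℤ.neg-distribʳ-* y i ⟨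
    - (y * i)      ≡⟨ ℤ.neg-distribˡ-* y i ⟩
    - y * i        ∎))
    where open ≡-Reasoning

  bézout₃ : ∀ a b c → gcd (gcd a b) c ≡ 1 → ∃ λ x → ∃₂ λ y z → 1ℤ ≡ x * + a + y * + b + z * + c
  bézout₃ a b c coprime with bézout a b | bézout (gcd a b) c
  ... | x , y , eq₁ | u , v , eq₂ = u * x , u * y , v , (begin
    1ℤ                                ≡⟨ cong +_ coprime ⟨
    + gcd (gcd a b) c                 ≡⟨ eq₂ ⟩
    u * + gcd a b + v * + c           ≡⟨ cong (λ w → u * w + v * + c) eq₁ ⟩
    u * (x * + a + y * + b) + v * + c ≡⟨ identity u v x y (+ a) (+ b) (+ c) ⟩
    u * x * + a + u * y * + b + v * + c ∎)
    where
    open ≡-Reasoning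
    identity : ∀ u v x y a b c → u * (x * a + y * b) + v * c ≡ u * x * a + u * y * b + v * c
    identity = solve-∀

  ∣m-n∣≡∣m⊖n∣ : ∀ m n → ℕ.∣ m - n ∣ ≡ ℤ.∣ m ⊖ n ∣
  ∣m-n∣≡∣m⊖n∣ ℕ.zero    ℕ.zero    = refl
  ∣m-n∣≡∣m⊖n∣ ℕ.zero    (ℕ.suc n) = refl
  ∣m-n∣≡∣m⊖n∣ (ℕ.suc m) ℕ.zero    = refl
  ∣m-n∣≡∣m⊖n∣ (ℕ.suc m) (ℕ.suc n) = trans (∣m-n∣≡∣m⊖n∣ m n) (sym (cong ℤ.∣_∣ (ℤ.[1+m]⊖[1+n]≡m⊖n m n)))

module Translations (n : ℕ) .{{_ : NonZero n}} where

  open import Data.Integer as ℤ using (+_; 0ℤ; 1ℤ; -1ℤ; _+_; _*_; -_; _-_)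
  import Data.Integer.Properties as ℤ
  open import Data.Integer.Tactic.RingSolver using (solve-∀)
  open Congruence

  infixl 6 _⊕_
  infixl 7 _⊙_

  _⊕_ : ∀ {k} → Vector ℤ k → Vector ℤ k → Vector ℤ k
  _⊕_ = zipWith _+_

  _⊙_ : ∀ {k} → ℤ → Vector ℤ k → Vector ℤ k
  x ⊙ c = map (x *_) c

  infix 4 _≋_
  _≋_ : Vector ℤ 3 → Vector ℤ 3 → Set
  c ≋ d = ∀ k → c k ≡ d k mod + n

  translate : Vector ℤ 3 → E n → E n
  translate c (i , k) = shift (c k) i , k

  translate-∘ : ∀ c d → translate c ∘ translate d ≗ translate (d ⊕ c)
  translate-∘ c d (i , k) = cong (_, k) (shift-shift (c k) (d k) i)

  translate-cong : ∀ {c d} → c ≋ d → translate c ≗ translate d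
  translate-cong c≋d (i , k) = cong (_, k) (shift-cong i (c≋d k))

  translate-zero : translate (replicate 3 0ℤ) ≗ id
  translate-zero (i , k) = cong (_, k) (shift-zero i)

  translate-injective : ∀ {c d} → translate c ≗ translate d → c ≋ d
  translate-injective eq k = shift-injective (reduce 0ℤ) (cong proj₁ (eq (reduce 0ℤ , k)))

  Span : Vector ℤ 3 → Vector ℤ 3 → Vector ℤ 3 → Set
  Span g h c = ∃₂ λ x y → c ≋ x ⊙ g ⊕ y ⊙ h

  module _ {g h : Vector ℤ 3} where

    span-left : Span g h g
    span-left = 1ℤ , 0ℤ , λ k → ≡⇒≡-mod (identity (g k) (h k))
      where
      identity : ∀ u v → u ≡ 1ℤ * u + 0ℤ * v
      identity = solve-∀

    span-right : Span g h h
    span-right = 0ℤ , 1ℤ , λ k → ≡⇒≡-mod (identity (g k) (h k))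
      where
      identity : ∀ u v → v ≡ 0ℤ * u + 1ℤ * v
      identity = solve-∀

    span-zero : Span g h (replicate 3 0ℤ)
    span-zero = 0ℤ , 0ℤ , λ k → ≡⇒≡-mod (identity (g k) (h k))
      where
      identity : ∀ u v → 0ℤ ≡ 0ℤ * u + 0ℤ * v
      identity = solve-∀

    span-⊕ : ∀ {c d} → Span g h c → Span g h d → Span g h (c ⊕ d)
    span-⊕ (x , y , c≋) (x′ , y′ , d≋) = x + x′ , y + y′ ,
      λ k → ≡-mod-trans (+-cong-mod (c≋ k) (d≋ k)) (≡⇒≡-mod (identity x y x′ y′ (g k) (h k)))
      where
      identity : ∀ x y x′ y′ u v → x * u + y * v + (x′ * u + y′ * v) ≡ (x + x′) * u + (y + y′) * v
      identity = solve-∀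

    span-neg : ∀ {c} → Span g h c → Span g h (-1ℤ ⊙ c)
    span-neg (x , y , c≋) = - x , - y ,
      λ k → ≡-mod-trans (*-congˡ-mod -1ℤ (c≋ k)) (≡⇒≡-mod (identity x y (g k) (h k)))
      where
      identity : ∀ x y u v → -1ℤ * (x * u + y * v) ≡ - x * u + - y * v
      identity = solve-∀

  module Generated {a b : E n → E n} {g h : Vector ℤ 3}
                   (a≗g : a ≗ translate g) (b≗h : b ≗ translate h) where

    Gen⇒Span : ∀ {f} → Gen a b f → ∃ λ c → Span g h c × f ≗ translate c
    Gen⇒Span gen-a = g , span-left , a≗g
    Gen⇒Span gen-b = h , span-right , b≗h
    Gen⇒Span gen-id = replicate 3 0ℤ , span-zero , λ x → sym (translate-zero x)
    Gen⇒Span (gen-comp {f} {f′} p p′) with Gen⇒Span p | Gen⇒Span p′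
    ... | c , c∈ , f≗c | d , d∈ , f′≗d =
      d ⊕ c , span-⊕ d∈ c∈ , λ x → trans (cong f (f′≗d x)) (trans (f≗c _) (translate-∘ c d x))
    Gen⇒Span (gen-inv {f} {f⁻¹} p f⁻¹∘f≗id _) with Gen⇒Span p
    ... | c , c∈ , f≗c = -1ℤ ⊙ c , span-neg c∈ ,
      λ x → trans (cong f⁻¹ (sym (f∘translate⁻¹ x))) (f⁻¹∘f≗id _)
      where
      identity : ∀ u → -1ℤ * u + u ≡ 0ℤ
      identity = solve-∀
      f∘translate⁻¹ : ∀ x → f (translate (-1ℤ ⊙ c) x) ≡ x
      f∘translate⁻¹ x = begin
        f (translate (-1ℤ ⊙ c) x)            ≡⟨ f≗c _ ⟩
        translate c (translate (-1ℤ ⊙ c) x)  ≡⟨ translate-∘ c (-1ℤ ⊙ c) x ⟩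
        translate (-1ℤ ⊙ c ⊕ c) x            ≡⟨ translate-cong (λ k → ≡⇒≡-mod (identity (c k))) x ⟩
        translate (replicate 3 0ℤ) x         ≡⟨ translate-zero x ⟩
        x                                    ∎
        where open ≡-Reasoning
    Gen⇒Span (gen-ext p f≗f′) with Gen⇒Span p
    ... | c , c∈ , f≗c = c , c∈ , λ x → trans (sym (f≗f′ x)) (f≗c x)

    power∈Gen : ∀ {u v} → Gen a b u → u ≗ translate v → ∀ k → Gen a b (translate (+ k ⊙ v))
    power∈Gen {v = v} u∈ u≗v ℕ.zero =
      gen-ext gen-id λ x →
        sym (trans (translate-cong (λ k → ≡⇒≡-mod (identity (v k))) x) (translate-zero x))
      where
      identity : ∀ w → 0ℤ * w ≡ 0ℤ
      identity = solve-∀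
    power∈Gen {u} {v} u∈ u≗v (ℕ.suc k) = gen-ext (gen-comp u∈ (power∈Gen u∈ u≗v k)) λ x → begin
      u (translate (+ k ⊙ v) x)            ≡⟨ u≗v _ ⟩
      translate v (translate (+ k ⊙ v) x)  ≡⟨ translate-∘ v (+ k ⊙ v) x ⟩
      translate (+ k ⊙ v ⊕ v) x            ≡⟨ translate-cong (λ i → ≡⇒≡-mod (identity (+ k) (v i))) x ⟩
      translate (+ ℕ.suc k ⊙ v) x          ∎
      where
      open ≡-Reasoning
      identity : ∀ k w → k * w + w ≡ (1ℤ + k) * w
      identity = solve-∀

    Span⇒Gen : ∀ {c} → Span g h c → Gen a b (translate c)
    Span⇒Gen {c} (x , y , c≋) =
      gen-ext (gen-comp (power∈Gen gen-a a≗g X) (power∈Gen gen-b b≗h Y)) λ z →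
        trans (translate-∘ (+ X ⊙ g) (+ Y ⊙ h) z) (translate-cong coordinates z)
      where
      X = toℕ (reduce {n} x)
      Y = toℕ (reduce {n} y)
      coordinates : + Y ⊙ h ⊕ + X ⊙ g ≋ c
      coordinates k = begin
        + Y * h k + + X * g k  ≈⟨ +-cong-mod (*-congʳ-mod (h k) (≡-mod-reduce y))
                                              (*-congʳ-mod (g k) (≡-mod-reduce x)) ⟨
        y * h k + x * g k      ≡⟨ ℤ.+-comm (y * h k) (x * g k) ⟩
        x * g k + y * h k      ≈⟨ c≋ k ⟨
        c k                    ∎
        where open ≡-mod-Reasoning (+ n)

  coordinate-sum : Vector ℤ 3 → ℤ
  coordinate-sum c = c 0F + c 1F + c 2F

  ≋-from-first-two : ∀ {c d} → coordinate-sum c ≡ 0ℤ mod + n → coordinate-sum d ≡ 0ℤ mod + n →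
                     c 0F ≡ d 0F mod + n → c 1F ≡ d 1F mod + n → c ≋ d
  ≋-from-first-two _  _  c₀≡d₀ _     0F = c₀≡d₀
  ≋-from-first-two _  _  _     c₁≡d₁ 1F = c₁≡d₁
  ≋-from-first-two {c} {d} Σc≡0 Σd≡0 c₀≡d₀ c₁≡d₁ 2F = begin
    c 2F                              ≡⟨ identity (c 0F) (c 1F) (c 2F) ⟩
    coordinate-sum c - (c 0F + c 1F)  ≈⟨ +-cong-mod (≡-mod-trans Σc≡0 (≡-mod-sym Σd≡0))
                                                    (neg-cong-mod (+-cong-mod c₀≡d₀ c₁≡d₁)) ⟩
    coordinate-sum d - (d 0F + d 1F)  ≡⟨ identity (d 0F) (d 1F) (d 2F) ⟨
    d 2F                              ∎
    where
    open ≡-mod-Reasoning (+ n)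
    identity : ∀ a b c → c ≡ a + b + c - (a + b)
    identity = solve-∀

module Lattice (p₀ p₁ p₂ : ℕ) .{{_ : NonZero (p₀ ℕ.+ p₁ ℕ.+ p₂)}}
               (coprime : gcd (gcd p₀ p₁) p₂ ≡ 1) where

  open import Data.Integer as ℤ using (+_; 0ℤ; 1ℤ; _+_; _*_; -_; _-_; _⊖_)
  import Data.Integer.Properties as ℤ
  open import Data.Integer.Divisibility.Signed using (_∣_; ∣ᵤ⇒∣; ∣m∣n⇒∣m+n; ∣m∣n⇒∣m-n; ∣n⇒∣m*n; divides)
  open import Data.Integer.Tactic.RingSolver using (solve-∀)
  open import Data.Nat.GCD using (gcd[m,n]≢0; m/gcd[m,n]≢0)
  open import Data.Vec.Functional using ([]; _∷_)
  open Congruence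
  open IntegerBézout

  n : ℕ
  n = p₀ ℕ.+ p₁ ℕ.+ p₂

  α : ℕ
  α = gcd n ℕ.∣ p₀ ℕ.* p₁ - p₂ ℕ.* p₂ ∣

  instance
    α-nonZero : NonZero α
    α-nonZero = ℕ.≢-nonZero (gcd[m,n]≢0 n _ (inj₁ (ℕ.≢-nonZero⁻¹ n)))

  n/α : ℕ
  n/α = n ℕ./ α

  instance
    n/α-nonZero : NonZero n/α
    n/α-nonZero = ℕ.≢-nonZero (m/gcd[m,n]≢0 n _)

  n≡n/α*α : n ≡ n/α ℕ.* α
  n≡n/α*α = sym (ℕ.m/n*n≡m (gcd[m,n]∣m n _))

  open Translations n

  P₀ P₁ P₂ D : ℤ
  P₀ = + p₀
  P₁ = + p₁
  P₂ = + p₂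
  D = P₀ * P₁ - P₂ * P₂

  ∣D∣≡∣p₀p₁-p₂p₂∣ : ℤ.∣ D ∣ ≡ ℕ.∣ p₀ ℕ.* p₁ - p₂ ℕ.* p₂ ∣
  ∣D∣≡∣p₀p₁-p₂p₂∣ = begin
    ℤ.∣ D ∣                               ≡⟨ cong ℤ.∣_∣ (cong₂ _-_ (ℤ.pos-* p₀ p₁) (ℤ.pos-* p₂ p₂)) ⟨
    ℤ.∣ + (p₀ ℕ.* p₁) - + (p₂ ℕ.* p₂) ∣   ≡⟨ cong ℤ.∣_∣ (ℤ.m-n≡m⊖n (p₀ ℕ.* p₁) (p₂ ℕ.* p₂)) ⟩
    ℤ.∣ p₀ ℕ.* p₁ ⊖ p₂ ℕ.* p₂ ∣           ≡⟨ ∣m-n∣≡∣m⊖n∣ (p₀ ℕ.* p₁) (p₂ ℕ.* p₂) ⟨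
    ℕ.∣ p₀ ℕ.* p₁ - p₂ ℕ.* p₂ ∣           ∎
    where open ≡-Reasoning

  n≡P₀+P₁+P₂ : + n ≡ P₀ + P₁ + P₂
  n≡P₀+P₁+P₂ = trans (ℤ.pos-+ (p₀ ℕ.+ p₁) p₂) (cong (_+ P₂) (ℤ.pos-+ p₀ p₁))

  α∣n : + α ∣ + n
  α∣n = ∣ᵤ⇒∣ (gcd[m,n]∣m n _)

  α∣D : + α ∣ D
  α∣D = ∣ᵤ⇒∣ (subst (α ℕ.∣_) (sym ∣D∣≡∣p₀p₁-p₂p₂∣) (gcd[m,n]∣n n _))

  bézout-α : ∃₂ λ r s → + α ≡ r * + n + s * D
  bézout-α = subst (λ a → ∃₂ λ r s → + gcd n a ≡ r * + n + s * D) ∣D∣≡∣p₀p₁-p₂p₂∣ (bézoutℤ n D)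

  R S : ℤ
  R = proj₁ bézout-α
  S = proj₁ (proj₂ bézout-α)

  α≡Rn+SD : + α ≡ R * + n + S * D
  α≡Rn+SD = proj₂ (proj₂ bézout-α)

  bézout-1 : ∃ λ x → ∃₂ λ y z → 1ℤ ≡ x * P₁ + y * P₂ + z * + n
  bézout-1 = bézout₃ p₁ p₂ n (gcd[gcd[p,q],r]≡1⇒gcd[gcd[q,r],p+q+r]≡1 p₀ p₁ p₂ coprime)

  X Y Z : ℤ
  X = proj₁ bézout-1
  Y = proj₁ (proj₂ bézout-1)
  Z = proj₁ (proj₂ (proj₂ bézout-1))

  1≡XP₁+YP₂+Zn : 1ℤ ≡ X * P₁ + Y * P₂ + Z * + n
  1≡XP₁+YP₂+Zn = proj₂ (proj₂ (proj₂ bézout-1))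

  -- As P₀P₁ ≡ P₂² (mod α), we get e P₁ ≡ P₂ and e P₂ ≡ P₀ (mod α): multiplication by e
  -- sends the first coordinate of g and of h to their second one.
  e : ℤ
  e = X * P₂ + Y * P₀

  α∣P₂-eP₁ : + α ∣ P₂ - e * P₁
  α∣P₂-eP₁ = subst (+ α ∣_) (sym expand) (∣m∣n⇒∣m-n (∣n⇒∣m*n (P₂ * Z) α∣n) (∣n⇒∣m*n Y α∣D))
    where
    open ≡-Reasoning
    identity : ∀ P₀ P₁ P₂ X Y Z N →
               P₂ * (X * P₁ + Y * P₂ + Z * N) - (X * P₂ + Y * P₀) * P₁ ≡
               P₂ * Z * N - Y * (P₀ * P₁ - P₂ * P₂)
    identity = solve-∀
    expand : P₂ - e * P₁ ≡ P₂ * Z * + n - Y * D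
    expand = begin
      P₂ - e * P₁                               ≡⟨ cong (_- e * P₁) (ℤ.*-identityʳ P₂) ⟨
      P₂ * 1ℤ - e * P₁                          ≡⟨ cong (λ u → P₂ * u - e * P₁) 1≡XP₁+YP₂+Zn ⟩
      P₂ * (X * P₁ + Y * P₂ + Z * + n) - e * P₁ ≡⟨ identity P₀ P₁ P₂ X Y Z (+ n) ⟩
      P₂ * Z * + n - Y * D                      ∎

  α∣P₀-eP₂ : + α ∣ P₀ - e * P₂
  α∣P₀-eP₂ = subst (+ α ∣_) (sym expand) (∣m∣n⇒∣m+n (∣n⇒∣m*n (P₀ * Z) α∣n) (∣n⇒∣m*n X α∣D))
    where
    open ≡-Reasoning
    identity : ∀ P₀ P₁ P₂ X Y Z N →
               P₀ * (X * P₁ + Y * P₂ + Z * N) - (X * P₂ + Y * P₀) * P₂ ≡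
               P₀ * Z * N + X * (P₀ * P₁ - P₂ * P₂)
    identity = solve-∀
    expand : P₀ - e * P₂ ≡ P₀ * Z * + n + X * D
    expand = begin
      P₀ - e * P₂                               ≡⟨ cong (_- e * P₂) (ℤ.*-identityʳ P₀) ⟨
      P₀ * 1ℤ - e * P₂                          ≡⟨ cong (λ u → P₀ * u - e * P₂) 1≡XP₁+YP₂+Zn ⟩
      P₀ * (X * P₁ + Y * P₂ + Z * + n) - e * P₂ ≡⟨ identity P₀ P₁ P₂ X Y Z (+ n) ⟩
      P₀ * Z * + n + X * D                      ∎

  g h : Vector ℤ 3
  g = - P₁ ∷ - P₂ ∷ - P₀ ∷ []
  h = - P₂ ∷ - P₀ ∷ - P₁ ∷ []

  σ₀σ₁≗translate-g : σ₀ ∘ σ₁ p₀ p₁ p₂ ≗ translate g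
  σ₀σ₁≗translate-g (i , 0F) = cong (_, 0F) (subMod≡shift i p₁)
  σ₀σ₁≗translate-g (i , 1F) = cong (_, 1F) (subMod≡shift i p₂)
  σ₀σ₁≗translate-g (i , 2F) = cong (_, 2F) (subMod≡shift i p₀)

  σ₁σ₀≗translate-h : σ₁ p₀ p₁ p₂ ∘ σ₀ ≗ translate h
  σ₁σ₀≗translate-h (i , 0F) = cong (_, 0F) (subMod≡shift i p₂)
  σ₁σ₀≗translate-h (i , 1F) = cong (_, 1F) (subMod≡shift i p₀)
  σ₁σ₀≗translate-h (i , 2F) = cong (_, 2F) (subMod≡shift i p₁)

  span⇒zero-sum : ∀ {c} → Span g h c → coordinate-sum c ≡ 0ℤ mod + n
  span⇒zero-sum {c} (x , y , c≋) = begin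
    coordinate-sum c                 ≈⟨ +-cong-mod (+-cong-mod (c≋ 0F) (c≋ 1F)) (c≋ 2F) ⟩
    coordinate-sum (x ⊙ g ⊕ y ⊙ h)   ≡⟨ identity x y P₀ P₁ P₂ ⟩
    - (x + y) * (P₀ + P₁ + P₂)       ≡⟨ cong (- (x + y) *_) n≡P₀+P₁+P₂ ⟨
    - (x + y) * + n                  ≈⟨ *-multiple≡0-mod (- (x + y)) ⟩
    0ℤ                               ∎
    where
    open ≡-mod-Reasoning (+ n)
    identity : ∀ x y P₀ P₁ P₂ → x * - P₁ + y * - P₂ + (x * - P₂ + y * - P₀) + (x * - P₀ + y * - P₁) ≡
                                 - (x + y) * (P₀ + P₁ + P₂)
    identity = solve-∀

  span⇒slope : ∀ {c} → Span g h c → + α ∣ c 1F - e * c 0F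
  span⇒slope {c} (x , y , c≋) = ∣-resp-≡-mod α∣n in-terms-of-generators
    (subst (+ α ∣_) (sym (identity x y e P₀ P₁ P₂))
      (∣m∣n⇒∣m-n (∣n⇒∣m*n (- x) α∣P₂-eP₁) (∣n⇒∣m*n y α∣P₀-eP₂)))
    where
    in-terms-of-generators : c 1F - e * c 0F ≡ (x * - P₂ + y * - P₀) - e * (x * - P₁ + y * - P₂) mod + n
    in-terms-of-generators = +-cong-mod (c≋ 1F) (neg-cong-mod (*-congˡ-mod e (c≋ 0F)))
    identity : ∀ x y e P₀ P₁ P₂ → (x * - P₂ + y * - P₀) - e * (x * - P₁ + y * - P₂) ≡
                                   - x * (P₂ - e * P₁) - y * (P₀ - e * P₂)
    identity = solve-∀

  +n≡n/α*α : + n ≡ + n/α * + α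
  +n≡n/α*α = trans (cong +_ n≡n/α*α) (ℤ.pos-* n/α α)

  *α-scale-mod : ∀ {a b} → a ≡ b mod + n/α → a * + α ≡ b * + α mod + n
  *α-scale-mod {a} {b} a≡b =
    subst (λ m → a * + α ≡ b * + α mod m) (sym +n≡n/α*α) (*-scale-mod (+ α) a≡b)

  *α-cancel-mod : ∀ {a b} → a * + α ≡ b * + α mod + n → a ≡ b mod + n/α
  *α-cancel-mod {a} {b} aα≡bα =
    *-cancelʳ-scaled-mod (+ α) (subst (λ m → a * + α ≡ b * + α mod m) +n≡n/α*α aα≡bα)

  point : Fin n → Fin n/α → Vector ℤ 3
  point s k = + toℕ s ∷ t ∷ - (+ toℕ s + t) ∷ []
    where t = e * + toℕ s + + toℕ k * + α

  point-zero-sum : ∀ s k → coordinate-sum (point s k) ≡ 0ℤ mod + n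
  point-zero-sum s k = ≡⇒≡-mod (identity (point s k 0F) (point s k 1F))
    where
    identity : ∀ a b → a + b + - (a + b) ≡ 0ℤ
    identity = solve-∀

  point-injective : ∀ {s k s′ k′} → point s k ≋ point s′ k′ → (s , k) ≡ (s′ , k′)
  point-injective {s} {k} {s′} {k′} eq with toℕ-injective-mod s s′ (eq 0F)
  ... | refl = cong (s ,_) (toℕ-injective-mod k k′ (*α-cancel-mod (+-cancelˡ-mod (e * + toℕ s) (eq 1F))))

  zero-sum-on-slope⇒point : ∀ {c} → coordinate-sum c ≡ 0ℤ mod + n → + α ∣ c 1F - e * c 0F →
                            ∃₂ λ s k → c ≋ point s k
  zero-sum-on-slope⇒point {c} Σc≡0 (divides T c₁-ec₀≡Tα) =
    s , k , ≋-from-first-two Σc≡0 (point-zero-sum s k) (≡-mod-reduce (c 0F)) second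
    where
    s : Fin n
    s = reduce (c 0F)
    k : Fin n/α
    k = reduce T
    open ≡-mod-Reasoning (+ n)
    identity : ∀ a b → a ≡ b + (a - b)
    identity = solve-∀
    second : c 1F ≡ e * + toℕ s + + toℕ k * + α mod + n
    second = begin
      c 1F                          ≡⟨ identity (c 1F) (e * c 0F) ⟩
      e * c 0F + (c 1F - e * c 0F)  ≡⟨ cong (_+_ (e * c 0F)) c₁-ec₀≡Tα ⟩
      e * c 0F + T * + α            ≈⟨ +-cong-mod (*-congˡ-mod e (≡-mod-reduce (c 0F)))
                                                  (*α-scale-mod (≡-mod-reduce T)) ⟩
      e * + toℕ s + + toℕ k * + α   ∎

  point∈span : ∀ s k → Span g h (point s k)
  point∈span s k = x , y ,
    ≋-from-first-two (point-zero-sum s k) (span⇒zero-sum (x , y , λ _ → ≡-mod-refl)) first second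
    where
    s′ = + toℕ s
    k′ = + toℕ k
    -- The coefficients −s′(X, Y) give first coordinate ≡ s′ (mod n), while k′S(P₂, −P₁) give
    -- first coordinate 0 and second coordinate k′SD ≡ k′α (mod n).
    x = - (s′ * X - k′ * S * P₂)
    y = - (s′ * Y + k′ * S * P₁)
    open ≡-Reasoning
    identity₀ : ∀ s k S X Y Z P₁ P₂ N → s * (X * P₁ + Y * P₂ + Z * N) ≡
                (- (s * X - k * S * P₂)) * - P₁ + (- (s * Y + k * S * P₁)) * - P₂ + s * Z * N
    identity₀ = solve-∀
    first : s′ ≡ x * - P₁ + y * - P₂ mod + n
    first = congruent (s′ * Z) (begin
      s′                                 ≡⟨ ℤ.*-identityʳ s′ ⟨
      s′ * 1ℤ                            ≡⟨ cong (s′ *_) 1≡XP₁+YP₂+Zn ⟩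
      s′ * (X * P₁ + Y * P₂ + Z * + n)   ≡⟨ identity₀ s′ k′ S X Y Z P₁ P₂ (+ n) ⟩
      x * - P₁ + y * - P₂ + s′ * Z * + n ∎)
    identity₁ : ∀ s k S R X Y P₀ P₁ P₂ N →
                (X * P₂ + Y * P₀) * s + k * (R * N + S * (P₀ * P₁ - P₂ * P₂)) ≡
                (- (s * X - k * S * P₂)) * - P₂ + (- (s * Y + k * S * P₁)) * - P₀ + k * R * N
    identity₁ = solve-∀
    second : e * s′ + k′ * + α ≡ x * - P₂ + y * - P₀ mod + n
    second = congruent (k′ * R) (begin
      e * s′ + k′ * + α                   ≡⟨ cong (λ a → e * s′ + k′ * a) α≡Rn+SD ⟩
      e * s′ + k′ * (R * + n + S * D)     ≡⟨ identity₁ s′ k′ S R X Y P₀ P₁ P₂ (+ n) ⟩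
      x * - P₂ + y * - P₀ + k′ * R * + n  ∎)

  span⇒point : ∀ {c} → Span g h c → ∃₂ λ s k → c ≋ point s k
  span⇒point c∈ = zero-sum-on-slope⇒point (span⇒zero-sum c∈) (span⇒slope c∈)

  generated-group-order : HasOrder (Gen (σ₀ ∘ σ₁ p₀ p₁ p₂) (σ₁ p₀ p₁ p₂ ∘ σ₀)) (n ℕ.* n/α)
  generated-group-order = hasOrder-↔ *↔× (translate ∘ uncurry point)
    (λ (s , k) → Span⇒Gen (point∈span s k))
    (λ _ _ eq → point-injective (translate-injective eq))
    covered
    where
    open Generated {g = g} {h} σ₀σ₁≗translate-g σ₁σ₀≗translate-h
    covered : ∀ f → Gen (σ₀ ∘ σ₁ p₀ p₁ p₂) (σ₁ p₀ p₁ p₂ ∘ σ₀) f → ∃ λ b → f ≗ translate (uncurry point b)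
    covered f f∈ =
      let c , c∈ , f≗c = Gen⇒Span f∈
          s , k , c≋ = span⇒point c∈
      in (s , k) , λ x → trans (f≗c x) (translate-cong c≋ x)

open import Data.Nat using (_+_; _*_; ∣_-_∣)

lemma3 : (p₀ p₁ p₂ : ℕ) → 0 < p₀ → 0 < p₁ → 0 < p₂ →
    gcd (gcd p₀ p₁) p₂ ≡ 1 →
    (N : ℕ) → N * gcd (p₀ + p₁ + p₂) ∣ p₀ * p₁ - p₂ * p₂ ∣ ≡ (p₀ + p₁ + p₂) * (p₀ + p₁ + p₂) →
    HasOrder {E (p₀ + p₁ + p₂)}
      (Gen (σ₀ ∘ σ₁ p₀ p₁ p₂) (σ₁ p₀ p₁ p₂ ∘ σ₀)) N
lemma3 p₀@(ℕ.suc _) p₁ p₂ _ _ _ coprime N N*α≡n*n =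
  subst (HasOrder _) (sym N≡n*[n/α]) generated-group-order
  where
  open Lattice p₀ p₁ p₂ coprime
  N≡n*[n/α] : N ≡ n * n/α
  N≡n*[n/α] = ℕ.*-cancelʳ-≡ N (n * n/α) α (begin
    N * α           ≡⟨ N*α≡n*n ⟩
    n * n           ≡⟨ cong (n *_) n≡n/α*α ⟩
    n * (n/α * α)   ≡⟨ ℕ.*-assoc n n/α α ⟨
    n * n/α * α     ∎)
    where open ≡-Reasoning
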